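{- For every nonnegative integer $n$, the following hold: \begin{enumerate} \item[(a$'$)] $G_0(n) = \frac{1}{2}\bigl(G(n) + H(n)\bigr)$; \item[(b$'$)] $G_1(n) = \frac{1}{2}\bigl(G(n) - H(n)\bigr)$; \item[(c$'$)] $G_2(n) = \frac{1}{2}\bigl(G(n) + (-1)^n H(n)\bigr)$; \item[(d$'$)] $G_3(n) = \frac{1}{2}\bigl(G(n) - (-1)^n H(n)\bigr)$; \item[(e$'$)] $G_4(n) = \frac{1}{2}\bigl(G(n) + (-1)^n K(n)\bigr)$; \item[(f$'$)] $G_5(n) = \frac{1}{2}\bigl(G(n) - (-1)^n K(n)\bigr)$. \end{enumerate}
   Context: A two-color partition of $n$ is a partition of $n$ in which each part is colored either blue or green; parts of the same size but different colors are regarded as different, and parts of either color may repeat. Let $G(n)$ be the number of two-color partitions of $n$ in which odd parts may occur only in the blue color (even parts may be blue or green). Among the partitions counted by $G(n)$: $G_0(n)$ (resp. $G_1(n)$) is the number in which the number of blue even parts is even (resp. odd); $G_2(n)$ (resp. $G_3(n)$) is the number in which the number of blue parts is even (resp. odd); $G_4(n)$ (resp. $G_5(n)$) is the number in which the total number of parts is even (resp. odd). Let $H(n)$ be the number of (ordinary) partitions of $n$ in which the odd parts are distinct. Let $K(n)$ be the signed count $K(n)=\sum_\lambda (-1)^{j(\lambda)}$, where $\lambda$ ranges over partitions of $n$ into distinct parts in which every even part is congruent to $2$ modulo $4$, and $j(\lambda)$ is the number of even parts of $\lambda$; equivalently $\sum_{n\ge0}K(n)q^n=(q^2;q^4)_\infty(-q;q^2)_\infty$,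 where $(a;q)_\infty=\prod_{k\ge0}(1-aq^k)$. -}

module Defs where

open import Data.Nat using (ℕ; zero; suc; _+_; _*_; _∸_; _%_; _≡ᵇ_; _≤ᵇ_)
open import Data.Bool using (Bool; true; false; if_then_else_; _∧_; not)
open import Data.List using (List; []; _∷_; _++_; map; concatMap; length; upTo)
open import Data.Product using (_×_; _,_)
open import Data.Integer as ℤ using (ℤ; +_)

-- Ordinary partitions, represented as nonincreasing lists of positive parts.

-- The fuel argument only guarantees termination;
-- it is always started at m + n, which suffices since every recursive call
-- decreases m + n.
pb : ℕ → ℕ → ℕ → List (List ℕ)
pb _          _       zero    = [] ∷ []
pb _          zero    (suc n) = []
pb zero       (suc m) (suc n) = []
pb (suc fuel) (suc m) (suc n) =
  pb fuel m (suc n) ++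
  (if suc m ≤ᵇ suc n then map (suc m ∷_) (pb fuel (suc m) (suc n ∸ suc m)) else [])

partitions : ℕ → List (List ℕ)
partitions n = pb (n + n) n n

isEven : ℕ → Bool
isEven k = k % 2 ≡ᵇ 0

isOdd : ℕ → Bool
isOdd k = not (isEven k)

allᵇ : {A : Set} → (A → Bool) → List A → Bool
allᵇ p []       = true
allᵇ p (x ∷ xs) = p x ∧ allᵇ p xs

count : {A : Set} → (A → Bool) → List A → ℕ
count p []       = 0
count p (x ∷ xs) = if p x then suc (count p xs) else count p xs

mult : ℕ → List ℕ → ℕ
mult k = count (k ≡ᵇ_)

parity : ℕ → ℤ
parity zero          = + 1
parity (suc zero)    = ℤ.- (+ 1)
parity (suc (suc k)) = parity k

-- A two-color partition of n is identified with the pair (β , γ) of its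
-- blue parts β and green parts γ: β a partition of a, γ a partition of n ∸ a,
-- for some a ≤ n.  The condition "odd parts only blue" says γ has only even
-- parts.

twoColor : ℕ → List (List ℕ × List ℕ)
twoColor n =
  concatMap (λ a → concatMap (λ β → map (β ,_) (partitions (n ∸ a))) (partitions a))
            (upTo (suc n))

oddOnlyBlue : List ℕ × List ℕ → Bool
oddOnlyBlue (β , γ) = allᵇ isEven γ

Gset : ℕ → List (List ℕ × List ℕ)
Gset n = Data.List.filterᵇ oddOnlyBlue (twoColor n)

G : ℕ → ℕ
G n = length (Gset n)

G₀ G₁ : ℕ → ℕ
G₀ n = count (λ { (β , γ) → isEven (count isEven β) }) (Gset n)
G₁ n = count (λ { (β , γ) → isOdd  (count isEven β) }) (Gset n)

G₂ G₃ : ℕ → ℕ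
G₂ n = count (λ { (β , γ) → isEven (length β) }) (Gset n)
G₃ n = count (λ { (β , γ) → isOdd  (length β) }) (Gset n)

G₄ G₅ : ℕ → ℕ
G₄ n = count (λ { (β , γ) → isEven (length β + length γ) }) (Gset n)
G₅ n = count (λ { (β , γ) → isOdd  (length β + length γ) }) (Gset n)

oddPartsDistinct : List ℕ → Bool
oddPartsDistinct λs = allᵇ (λ x → if isOdd x then mult x λs ≤ᵇ 1 else true) λs

H : ℕ → ℕ
H n = count oddPartsDistinct (partitions n)

KAdmissible : List ℕ → Bool
KAdmissible λs =
  allᵇ (λ x → mult x λs ≤ᵇ 1) λs ∧
  allᵇ (λ x → if isEven x then x % 4 ≡ᵇ 2 else true) λs

sumℤ : List ℤ → ℤ
sumℤ []       = + 0
sumℤ (x ∷ xs) = x ℤ.+ sumℤ xs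

K : ℕ → ℤ
K n = sumℤ (map (λ λs → parity (count isEven λs))
                (Data.List.filterᵇ KAdmissible (partitions n)))

{-# OPTIONS --safe #-}
module Submission where

-- Each count is (G(n) ± S(n)) / 2, where S(n) sums over the partitions counted by G(n) the
-- sign (−1) ^ (statistic).  That sign is a product over the parts, so S(n) is the n-th
-- coefficient of the product of two weighted partition generating functions, one for the
-- blue parts and one for the (even) green parts.  A generating function of partitions
-- weighted by w, in which parts k with D k must be distinct, is the infinite product
-- ∏_{D k} (1 + w k qᵏ) / ∏_{¬ D k} (1 − w k qᵏ); the required product identities then hold
-- factor by factor, or, for K, by Euler's identity (−q; q)∞ (q; q²)∞ = 1 for q and q².
-- Infinite products are handled modulo q ^ (N + 1), where only finitely many factors matter.

open import Defs
open import Data.Nat using (ℕ)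
open import Data.Integer using (ℤ; +_; _+_; _-_; _*_)
open import Data.Product using (_×_)
open import Relation.Binary.PropositionalEquality using (_≡_)

open import Data.Bool using (Bool; true; false; if_then_else_; _∧_; not)
open import Data.Integer using (-_; 0ℤ; 1ℤ; -1ℤ)
import Data.Integer.Properties as ℤₚ
open import Algebra.Properties.AbelianGroup ℤₚ.+-0-abelianGroup using (∙-cancelʳ)
open import Algebra.Properties.CommutativeSemigroup ℤₚ.+-commutativeSemigroup using (x∙yz≈y∙xz)
open import Data.Integer.Tactic.RingSolver using (solve-∀)
open import Data.Nat using (zero; suc; _≤_; _<_; z≤n; s≤s; _≡ᵇ_; _≤ᵇ_; _∸_; _%_)
import Data.Nat as ℕ
import Data.Nat.Properties as ℕₚ
open import Data.Empty using (⊥-elim)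
open import Data.List using (List; []; _∷_; _++_; map; concatMap; filterᵇ; length; applyUpTo; upTo)
open import Data.Nat.ListAction using (sum)
open import Data.List.Relation.Unary.All as All using (All; []; _∷_)
open import Data.List.Properties using (map-upTo)
open import Data.List.Relation.Unary.All.Properties using (++⁺; map⁺)
open import Data.Product using (_,_; proj₁; proj₂)
open import Data.Sum using (inj₁; inj₂)
open import Function using (_∘_)
open import Relation.Binary.Bundles using (Setoid)
open import Relation.Binary.Structures using (IsEquivalence)
open import Relation.Nullary.Reflects using (Reflects; ofʸ; ofⁿ; fromEquivalence)
open import Relation.Binary.PropositionalEquality
  using (_≗_; _≢_; refl; sym; trans; cong; cong₂; subst; module ≡-Reasoning)

-- Formal power series

Series : Set
Series = ℕ → ℤ

one : Series
one zero    = 1ℤ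
one (suc _) = 0ℤ

tail : Series → Series
tail a n = a (suc n)

infixl 7 _⊛_
_⊛_ : Series → Series → Series
(a ⊛ b) zero    = a 0 * b 0
(a ⊛ b) (suc n) = a 0 * b (suc n) + (tail a ⊛ b) n

infixl 6 _⊕_
_⊕_ : Series → Series → Series
(a ⊕ b) n = a n + b n

infixr 7 _·_
_·_ : ℤ → Series → Series
(c · a) n = c * a n

-- multiplication by qᵉ
shift : ℕ → Series → Series
shift zero    a n       = a n
shift (suc e) a zero    = 0ℤ
shift (suc e) a (suc n) = shift e a n

binom : ℤ → ℕ → Series
binom c e = one ⊕ c · shift e one

⊛-cong≤ : ∀ {a a′ b b′} n → (∀ i → i ≤ n → a i ≡ a′ i) → (∀ i → i ≤ n → b i ≡ b′ i) →
          (a ⊛ b) n ≡ (a′ ⊛ b′) n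
⊛-cong≤ zero    a≡ b≡ = cong₂ _*_ (a≡ 0 z≤n) (b≡ 0 z≤n)
⊛-cong≤ (suc n) a≡ b≡ =
  cong₂ _+_ (cong₂ _*_ (a≡ 0 z≤n) (b≡ (suc n) ℕₚ.≤-refl))
            (⊛-cong≤ n (λ i i≤n → a≡ (suc i) (s≤s i≤n))
                       (λ i i≤n → b≡ i (ℕₚ.m≤n⇒m≤1+n i≤n)))

⊛-zeroˡ : ∀ b → (λ _ → 0ℤ) ⊛ b ≗ (λ _ → 0ℤ)
⊛-zeroˡ b zero    = refl
⊛-zeroˡ b (suc n) = trans (ℤₚ.+-identityˡ _) (⊛-zeroˡ b n)

⊛-identityˡ : ∀ b → one ⊛ b ≗ b
⊛-identityˡ b zero    = ℤₚ.*-identityˡ (b 0)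
⊛-identityˡ b (suc n) =
  trans (cong₂ _+_ (ℤₚ.*-identityˡ (b (suc n))) (⊛-zeroˡ b n)) (ℤₚ.+-identityʳ (b (suc n)))

⊛-scaleˡ : ∀ c a b → (c · a) ⊛ b ≗ c · (a ⊛ b)
⊛-scaleˡ c a b zero    = ℤₚ.*-assoc c (a 0) (b 0)
⊛-scaleˡ c a b (suc n) =
  trans (cong (_+_ (c * a 0 * b (suc n))) (⊛-scaleˡ c (tail a) b n)) (factor c (a 0) (b (suc n)) _)
  where
  factor : ∀ c x y z → c * x * y + c * z ≡ c * (x * y + z)
  factor = solve-∀

⊛-distribʳ : ∀ a a′ b → (a ⊕ a′) ⊛ b ≗ a ⊛ b ⊕ a′ ⊛ b
⊛-distribʳ a a′ b zero    = ℤₚ.*-distribʳ-+ (b 0) (a 0) (a′ 0)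
⊛-distribʳ a a′ b (suc n) =
  trans (cong (_+_ ((a 0 + a′ 0) * b (suc n))) (⊛-distribʳ (tail a) (tail a′) b n))
        (regroup (a 0) (a′ 0) (b (suc n)) _ _)
  where
  regroup : ∀ x y z u v → (x + y) * z + (u + v) ≡ (x * z + u) + (y * z + v)
  regroup = solve-∀

shift-⊛ : ∀ e a b → shift e a ⊛ b ≗ shift e (a ⊛ b)
shift-⊛ zero    a b n       = refl
shift-⊛ (suc e) a b zero    = refl
shift-⊛ (suc e) a b (suc n) = trans (ℤₚ.+-identityˡ _) (shift-⊛ e a b n)

⊛-comm : ∀ a b → a ⊛ b ≗ b ⊛ a
⊛-comm a b zero          = ℤₚ.*-comm (a 0) (b 0)
⊛-comm a b (suc zero)    = swap (a 0) (a 1) (b 0) (b 1)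
  where
  swap : ∀ a₀ a₁ b₀ b₁ → a₀ * b₁ + a₁ * b₀ ≡ b₀ * a₁ + b₁ * a₀
  swap = solve-∀
⊛-comm a b (suc (suc n)) = begin
  a 0 * b (suc (suc n)) + (tail a ⊛ b) (suc n)
    ≡⟨ cong (_+_ (a 0 * b (suc (suc n)))) (⊛-comm (tail a) b (suc n)) ⟩
  a 0 * b (suc (suc n)) + (b 0 * a (suc (suc n)) + (tail b ⊛ tail a) n)
    ≡⟨ cong (λ z → a 0 * b (suc (suc n)) + (b 0 * a (suc (suc n)) + z)) (⊛-comm (tail b) (tail a) n) ⟩
  a 0 * b (suc (suc n)) + (b 0 * a (suc (suc n)) + (tail a ⊛ tail b) n)
    ≡⟨ x∙yz≈y∙xz (a 0 * b (suc (suc n))) (b 0 * a (suc (suc n))) _ ⟩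
  b 0 * a (suc (suc n)) + (a 0 * b (suc (suc n)) + (tail a ⊛ tail b) n)
    ≡⟨ cong (_+_ (b 0 * a (suc (suc n)))) (⊛-comm a (tail b) (suc n)) ⟩
  b 0 * a (suc (suc n)) + (tail b ⊛ a) (suc n) ∎
  where open ≡-Reasoning

⊛-identityʳ : ∀ a → a ⊛ one ≗ a
⊛-identityʳ a n = trans (⊛-comm a one n) (⊛-identityˡ a n)

⊛-assoc : ∀ a b c → (a ⊛ b) ⊛ c ≗ a ⊛ (b ⊛ c)
⊛-assoc a b c zero    = ℤₚ.*-assoc (a 0) (b 0) (c 0)
⊛-assoc a b c (suc n) = begin
  a 0 * b 0 * c (suc n) + (tail (a ⊛ b) ⊛ c) n
    ≡⟨ cong (_+_ (a 0 * b 0 * c (suc n))) (⊛-distribʳ (a 0 · tail b) (tail a ⊛ b) c n) ⟩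
  a 0 * b 0 * c (suc n) + (((a 0 · tail b) ⊛ c) n + (tail a ⊛ b ⊛ c) n)
    ≡⟨ cong₂ (λ x y → a 0 * b 0 * c (suc n) + (x + y))
             (⊛-scaleˡ (a 0) (tail b) c n) (⊛-assoc (tail a) b c n) ⟩
  a 0 * b 0 * c (suc n) + (a 0 * (tail b ⊛ c) n + (tail a ⊛ (b ⊛ c)) n)
    ≡⟨ factor (a 0) (b 0) (c (suc n)) _ _ ⟩
  a 0 * (b 0 * c (suc n) + (tail b ⊛ c) n) + (tail a ⊛ (b ⊛ c)) n ∎
  where
  open ≡-Reasoning
  factor : ∀ a₀ b₀ x y z → a₀ * b₀ * x + (a₀ * y + z) ≡ a₀ * (b₀ * x + y) + z
  factor = solve-∀

shift-cong : ∀ e {a b} → a ≗ b → shift e a ≗ shift e b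
shift-cong zero    a≗b n       = a≗b n
shift-cong (suc e) a≗b zero    = refl
shift-cong (suc e) a≗b (suc n) = shift-cong e a≗b n

shift-⊕ : ∀ e a b → shift e (a ⊕ b) ≗ shift e a ⊕ shift e b
shift-⊕ zero    a b n       = refl
shift-⊕ (suc e) a b zero    = refl
shift-⊕ (suc e) a b (suc n) = shift-⊕ e a b n

shift-· : ∀ e c a → shift e (c · a) ≗ c · shift e a
shift-· zero    c a n       = refl
shift-· (suc e) c a zero    = sym (ℤₚ.*-zeroʳ c)
shift-· (suc e) c a (suc n) = shift-· e c a n

shift-shift : ∀ d e a → shift d (shift e a) ≗ shift (d ℕ.+ e) a
shift-shift zero    e a n       = refl
shift-shift (suc d) e a zero    = refl
shift-shift (suc d) e a (suc n) = shift-shift d e a n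

shift-below : ∀ e a {n} → n < e → shift e a n ≡ 0ℤ
shift-below (suc e) a {zero}  _         = refl
shift-below (suc e) a {suc n} (s≤s n<e) = shift-below e a n<e

shift-above : ∀ e a {n} → e ≤ n → shift e a n ≡ a (n ∸ e)
shift-above zero    a _         = refl
shift-above (suc e) a (s≤s e≤n) = shift-above e a e≤n

binom-⊛ : ∀ c e x → binom c e ⊛ x ≗ x ⊕ c · shift e x
binom-⊛ c e x n = begin
  (binom c e ⊛ x) n
    ≡⟨ ⊛-distribʳ one (c · shift e one) x n ⟩
  (one ⊛ x) n + ((c · shift e one) ⊛ x) n
    ≡⟨ cong₂ _+_ (⊛-identityˡ x n) (⊛-scaleˡ c (shift e one) x n) ⟩
  x n + c * (shift e one ⊛ x) n
    ≡⟨ cong (λ z → x n + c * z) (shift-⊛ e one x n) ⟩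
  x n + c * shift e (one ⊛ x) n
    ≡⟨ cong (λ z → x n + c * z) (shift-cong e (⊛-identityˡ x) n) ⟩
  x n + c * shift e x n ∎
  where open ≡-Reasoning

binom-zero : ∀ e → binom 0ℤ e ≗ one
binom-zero e n = ℤₚ.+-identityʳ (one n)

⊛-binom-zero : ∀ a k → a ⊛ binom 0ℤ k ≗ a
⊛-binom-zero a k n = trans (⊛-cong≤ n (λ _ _ → refl) (λ i _ → binom-zero k i)) (⊛-identityʳ a n)

binom-below : ∀ c e {n} → n < e → binom c e n ≡ one n
binom-below c e {n} n<e = begin
  one n + c * shift e one n ≡⟨ cong (λ z → one n + c * z) (shift-below e one n<e) ⟩
  one n + c * 0ℤ            ≡⟨ cong (_+_ (one n)) (ℤₚ.*-zeroʳ c) ⟩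
  one n + 0ℤ                ≡⟨ ℤₚ.+-identityʳ (one n) ⟩
  one n                     ∎
  where open ≡-Reasoning

binom-conj : ∀ c e → binom c e ⊛ binom (- c) e ≗ binom (- (c * c)) (e ℕ.+ e)
binom-conj c e n = begin
  (binom c e ⊛ binom (- c) e) n
    ≡⟨ binom-⊛ c e (binom (- c) e) n ⟩
  binom (- c) e n + c * shift e (one ⊕ - c · shift e one) n
    ≡⟨ cong (λ z → binom (- c) e n + c * z) (shift-⊕ e one (- c · shift e one) n) ⟩
  binom (- c) e n + c * (shift e one n + shift e (- c · shift e one) n)
    ≡⟨ cong (λ z → binom (- c) e n + c * (shift e one n + z)) (shift-· e (- c) (shift e one) n) ⟩
  binom (- c) e n + c * (shift e one n + - c * shift e (shift e one) n)
    ≡⟨ cong (λ z → binom (- c) e n + c * (shift e one n + - c * z)) (shift-shift e e one n) ⟩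
  (one n + - c * shift e one n) + c * (shift e one n + - c * shift (e ℕ.+ e) one n)
    ≡⟨ cancel (one n) c (shift e one n) (shift (e ℕ.+ e) one n) ⟩
  binom (- (c * c)) (e ℕ.+ e) n ∎
  where
  open ≡-Reasoning
  cancel : ∀ u c s t → (u + - c * s) + c * (s + - c * t) ≡ u + - (c * c) * t
  cancel = solve-∀

-- Infinite products

∏ : (ℕ → Series) → ℕ → Series
∏ F zero    = one
∏ F (suc M) = ∏ F M ⊛ F (suc M)

-- F k = 1 + O(q ^ k), so that the factors beyond k do not affect ∏ F below degree k.
Convergent : (ℕ → Series) → Set
Convergent F = ∀ k {n} → n ≤ k → F (suc k) n ≡ one n

binom-convergent : ∀ (c : ℕ → ℤ) (e : ℕ → ℕ) → (∀ k → k ≤ e k) →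
                   Convergent (λ k → binom (c k) (e k))
binom-convergent c e k≤e k n≤k = binom-below (c (suc k)) (e (suc k)) (ℕₚ.<-≤-trans (s≤s n≤k) (k≤e (suc k)))

binomᵏ-convergent : ∀ (c : ℕ → ℤ) → Convergent (λ k → binom (c k) k)
binomᵏ-convergent c = binom-convergent c (λ k → k) (λ _ → ℕₚ.≤-refl)

∏-constant : ∀ {F} → Convergent F → ∀ M → ∏ F M 0 ≡ 1ℤ
∏-constant F-conv zero    = refl
∏-constant F-conv (suc M) = cong₂ _*_ (∏-constant F-conv M) (F-conv M z≤n)

double : ℕ → ℕ
double zero    = zero
double (suc k) = suc (suc (double k))

double≡+ : ∀ k → double k ≡ k ℕ.+ k
double≡+ zero    = refl
double≡+ (suc k) = cong suc (trans (cong suc (double≡+ k)) (sym (ℕₚ.+-suc k k)))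

isEven-double : ∀ k → isEven (double k) ≡ true
isEven-double zero    = refl
isEven-double (suc k) = isEven-double k

isEven-suc-double : ∀ k → isEven (suc (double k)) ≡ false
isEven-suc-double zero    = refl
isEven-suc-double (suc k) = isEven-suc-double k

double-mod4 : ∀ j → (double j % 4 ≡ᵇ 2) ≡ not (isEven j)
double-mod4 zero          = refl
double-mod4 (suc zero)    = refl
double-mod4 (suc (suc j)) = double-mod4 j

double-inflationary : ∀ k → k ≤ double k
double-inflationary k = subst (k ≤_) (sym (double≡+ k)) (ℕₚ.m≤m+n k k)

binom-±1 : ∀ c k → c * c ≡ 1ℤ → binom c k ⊛ binom (- c) k ≗ binom -1ℤ (double k)
binom-±1 c k c²≡1 n = trans (binom-conj c k n) (cong₂ (λ c e → binom (- c) e n) c²≡1 (sym (double≡+ k)))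

onEven onOdd : (ℕ → Series) → ℕ → Series
onEven F k = if isEven k then F k else one
onOdd  F k = if isEven k then one else F k

onEven-convergent : ∀ {F} → Convergent F → Convergent (onEven F)
onEven-convergent F-conv k n≤k with isEven (suc k)
... | true  = F-conv k n≤k
... | false = refl

⊛-unitˡ-zero : ∀ c → c 0 ≡ 1ℤ → ∀ x → (c ⊛ x) 0 ≡ x 0
⊛-unitˡ-zero c c₀≡1 x = trans (cong (_* x 0) c₀≡1) (ℤₚ.*-identityˡ (x 0))

⊛-unitˡ-suc : ∀ c → c 0 ≡ 1ℤ → ∀ x m → (c ⊛ x) (suc m) ≡ x (suc m) + (tail c ⊛ x) m
⊛-unitˡ-suc c c₀≡1 x m =
  cong (_+ (tail c ⊛ x) m) (trans (cong (_* x (suc m)) c₀≡1) (ℤₚ.*-identityˡ (x (suc m))))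

⊛-cancel≤ : ∀ c {a b} → c 0 ≡ 1ℤ → ∀ m →
            (∀ i → i ≤ m → (c ⊛ a) i ≡ (c ⊛ b) i) → ∀ i → i ≤ m → a i ≡ b i
⊛-cancel≤ c {a} {b} c₀≡1 zero    ca≡cb .zero z≤n =
  trans (sym (⊛-unitˡ-zero c c₀≡1 a)) (trans (ca≡cb 0 z≤n) (⊛-unitˡ-zero c c₀≡1 b))
⊛-cancel≤ c {a} {b} c₀≡1 (suc m) ca≡cb i i≤1+m with ℕₚ.m≤n⇒m<n∨m≡n i≤1+m
... | inj₁ (s≤s i≤m) = ⊛-cancel≤ c c₀≡1 m (λ j j≤m → ca≡cb j (ℕₚ.m≤n⇒m≤1+n j≤m)) i i≤m
... | inj₂ refl      = ∙-cancelʳ ((tail c ⊛ a) m) (a (suc m)) (b (suc m)) (begin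
  a (suc m) + (tail c ⊛ a) m ≡⟨ ⊛-unitˡ-suc c c₀≡1 a m ⟨
  (c ⊛ a) (suc m)            ≡⟨ ca≡cb (suc m) ℕₚ.≤-refl ⟩
  (c ⊛ b) (suc m)            ≡⟨ ⊛-unitˡ-suc c c₀≡1 b m ⟩
  b (suc m) + (tail c ⊛ b) m ≡⟨ cong (_+_ (b (suc m))) (⊛-cong≤ m (λ _ _ → refl) below) ⟨
  b (suc m) + (tail c ⊛ a) m ∎)
  where
  open ≡-Reasoning
  below : ∀ i → i ≤ m → a i ≡ b i
  below = ⊛-cancel≤ c c₀≡1 m (λ j j≤m → ca≡cb j (ℕₚ.m≤n⇒m≤1+n j≤m))

-- Signs and finite sums

sign : Bool → ℤ
sign b = if b then 1ℤ else -1ℤ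

parity≡sign : ∀ k → parity k ≡ sign (isEven k)
parity≡sign zero          = refl
parity≡sign (suc zero)    = refl
parity≡sign (suc (suc k)) = parity≡sign k

parity-+ : ∀ m n → parity (m ℕ.+ n) ≡ parity m * parity n
parity-+ zero          n = sym (ℤₚ.*-identityˡ (parity n))
parity-+ (suc zero)    n = trans (parity-suc n) (sym (ℤₚ.-1*i≡-i (parity n)))
  where
  parity-suc : ∀ n → parity (suc n) ≡ - parity n
  parity-suc zero          = refl
  parity-suc (suc zero)    = refl
  parity-suc (suc (suc n)) = parity-suc n
parity-+ (suc (suc m)) n = parity-+ m n

Σ : {A : Set} → (A → ℤ) → List A → ℤ
Σ f xs = sumℤ (map f xs)

Σ-cong : ∀ {A : Set} {f g : A → ℤ} → f ≗ g → ∀ xs → Σ f xs ≡ Σ g xs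
Σ-cong f≗g []       = refl
Σ-cong f≗g (x ∷ xs) = cong₂ _+_ (f≗g x) (Σ-cong f≗g xs)

Σ-cong-All : ∀ {A : Set} {f g : A → ℤ} {xs} → All (λ x → f x ≡ g x) xs → Σ f xs ≡ Σ g xs
Σ-cong-All []           = refl
Σ-cong-All (fx≡gx ∷ eqs) = cong₂ _+_ fx≡gx (Σ-cong-All eqs)

Σ-zero : ∀ {A : Set} (xs : List A) → Σ (λ _ → 0ℤ) xs ≡ 0ℤ
Σ-zero []       = refl
Σ-zero (x ∷ xs) = trans (ℤₚ.+-identityˡ (Σ (λ _ → 0ℤ) xs)) (Σ-zero xs)

Σ-++ : ∀ {A : Set} (f : A → ℤ) xs ys → Σ f (xs ++ ys) ≡ Σ f xs + Σ f ys
Σ-++ f []       ys = sym (ℤₚ.+-identityˡ (Σ f ys))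
Σ-++ f (x ∷ xs) ys = trans (cong (_+_ (f x)) (Σ-++ f xs ys)) (sym (ℤₚ.+-assoc (f x) (Σ f xs) (Σ f ys)))

Σ-map : ∀ {A B : Set} (f : B → ℤ) (g : A → B) xs → Σ f (map g xs) ≡ Σ (f ∘ g) xs
Σ-map f g []       = refl
Σ-map f g (x ∷ xs) = cong (_+_ (f (g x))) (Σ-map f g xs)

Σ-concatMap : ∀ {A B : Set} (f : B → ℤ) (g : A → List B) xs →
              Σ f (concatMap g xs) ≡ Σ (λ x → Σ f (g x)) xs
Σ-concatMap f g []       = refl
Σ-concatMap f g (x ∷ xs) = trans (Σ-++ f (g x) (concatMap g xs)) (cong (_+_ (Σ f (g x))) (Σ-concatMap f g xs))

Σ-filterᵇ : ∀ {A : Set} (p : A → Bool) (f : A → ℤ) xs →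
            Σ f (filterᵇ p xs) ≡ Σ (λ x → if p x then f x else 0ℤ) xs
Σ-filterᵇ p f []       = refl
Σ-filterᵇ p f (x ∷ xs) with p x
... | true  = cong (_+_ (f x)) (Σ-filterᵇ p f xs)
... | false = trans (Σ-filterᵇ p f xs) (sym (ℤₚ.+-identityˡ _))

Σ-*ˡ : ∀ {A : Set} c (f : A → ℤ) xs → Σ (λ x → c * f x) xs ≡ c * Σ f xs
Σ-*ˡ c f []       = sym (ℤₚ.*-zeroʳ c)
Σ-*ˡ c f (x ∷ xs) = trans (cong (_+_ (c * f x)) (Σ-*ˡ c f xs)) (sym (ℤₚ.*-distribˡ-+ c (f x) (Σ f xs)))

Σ-*ʳ : ∀ {A : Set} c (f : A → ℤ) xs → Σ (λ x → f x * c) xs ≡ Σ f xs * c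
Σ-*ʳ c f xs = trans (Σ-cong (λ x → ℤₚ.*-comm (f x) c) xs) (trans (Σ-*ˡ c f xs) (ℤₚ.*-comm c (Σ f xs)))

≡ᵇ-reflects-≡ : ∀ m n → Reflects (m ≡ n) (m ≡ᵇ n)
≡ᵇ-reflects-≡ m n = fromEquivalence (ℕₚ.≡ᵇ⇒≡ m n) (ℕₚ.≡⇒≡ᵇ m n)

mult-head : ∀ k λs → mult k (k ∷ λs) ≡ suc (mult k λs)
mult-head k λs with k ≡ᵇ k | ≡ᵇ-reflects-≡ k k
... | true  | _        = refl
... | false | ofⁿ k≢k = ⊥-elim (k≢k refl)

mult-absent : ∀ {k λs} → All (_≢ k) λs → mult k λs ≡ 0
mult-absent                  []                = refl
mult-absent {k} {x ∷ λs} (x≢k ∷ absent) with k ≡ᵇ x | ≡ᵇ-reflects-≡ k x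
... | true  | ofʸ k≡x = ⊥-elim (x≢k (sym k≡x))
... | false | _       = mult-absent absent

mult≡0⇒absent : ∀ {k} λs → mult k λs ≡ 0 → All (_≢ k) λs
mult≡0⇒absent         []       _ = []
mult≡0⇒absent {k} (x ∷ λs) multk≡0 with k ≡ᵇ x | ≡ᵇ-reflects-≡ k x
... | false | ofⁿ k≢x = (λ x≡k → k≢x (sym x≡k)) ∷ mult≡0⇒absent λs multk≡0

-- Weighted partitions

boundedPartitions : ℕ → ℕ → List (List ℕ)
boundedPartitions m n = pb (m ℕ.+ n) m n

pb-bounded : ∀ f m n → All (All (_≤ m)) (pb f m n)
pb-bounded _       _       zero    = [] ∷ []
pb-bounded _       zero    (suc n) = []
pb-bounded zero    (suc m) (suc n) = []
pb-bounded (suc f) (suc m) (suc n) =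
  ++⁺ (All.map (All.map ℕₚ.m≤n⇒m≤1+n) (pb-bounded f m (suc n))) new
  where
  new : All (All (_≤ suc m)) (if suc m ≤ᵇ suc n then map (suc m ∷_) (pb f (suc m) (n ∸ m)) else [])
  new with suc m ≤ᵇ suc n
  ... | true  = map⁺ (All.map (ℕₚ.≤-refl ∷_) (pb-bounded f (suc m) (n ∸ m)))
  ... | false = []

pb-sum : ∀ f m n → All (λ λs → sum λs ≡ n) (pb f m n)
pb-sum _       _       zero    = refl ∷ []
pb-sum _       zero    (suc n) = []
pb-sum zero    (suc m) (suc n) = []
pb-sum (suc f) (suc m) (suc n) = ++⁺ (pb-sum f m (suc n)) new
  where
  new : All (λ λs → sum λs ≡ suc n) (if suc m ≤ᵇ suc n then map (suc m ∷_) (pb f (suc m) (n ∸ m)) else [])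
  new with suc m ≤ᵇ suc n | ℕₚ.≤ᵇ-reflects-≤ (suc m) (suc n)
  ... | true  | ofʸ (s≤s m≤n) =
    map⁺ (All.map (λ sum≡n∸m → cong suc (trans (cong (m ℕ.+_) sum≡n∸m) (ℕₚ.m+[n∸m]≡n m≤n)))
                  (pb-sum f (suc m) (n ∸ m)))
  ... | false | _             = []

1+m+[n∸m]≤m+1+n : ∀ m n → suc m ℕ.+ (n ∸ m) ≤ m ℕ.+ suc n
1+m+[n∸m]≤m+1+n m n =
  subst (suc m ℕ.+ (n ∸ m) ≤_) (sym (ℕₚ.+-suc m n)) (s≤s (ℕₚ.+-monoʳ-≤ m (ℕₚ.m∸n≤m n m)))

pb-fuel : ∀ f g m n → m ℕ.+ n ≤ f → m ℕ.+ n ≤ g → pb f m n ≡ pb g m n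
pb-fuel _       _       _       zero    _         _         = refl
pb-fuel _       _       zero    (suc n) _         _         = refl
pb-fuel (suc f) (suc g) (suc m) (suc n) (s≤s m+n≤f) (s≤s m+n≤g) =
  cong₂ (λ xs ys → xs ++ (if suc m ≤ᵇ suc n then map (suc m ∷_) ys else []))
        (pb-fuel f g m (suc n) m+n≤f m+n≤g)
        (pb-fuel f g (suc m) (n ∸ m) (ℕₚ.≤-trans (1+m+[n∸m]≤m+1+n m n) m+n≤f)
                               (ℕₚ.≤-trans (1+m+[n∸m]≤m+1+n m n) m+n≤g))

boundedPartitions-suc : ∀ m n → boundedPartitions (suc m) (suc n) ≡
  boundedPartitions m (suc n) ++
  (if suc m ≤ᵇ suc n then map (suc m ∷_) (boundedPartitions (suc m) (n ∸ m)) else [])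
boundedPartitions-suc m n =
  cong (λ ys → boundedPartitions m (suc n) ++ (if suc m ≤ᵇ suc n then map (suc m ∷_) ys else []))
       (pb-fuel (m ℕ.+ suc n) (suc m ℕ.+ (n ∸ m)) (suc m) (n ∸ m) (1+m+[n∸m]≤m+1+n m n) ℕₚ.≤-refl)

weight : (ℕ → ℤ) → List ℕ → ℤ
weight w []       = 1ℤ
weight w (k ∷ λs) = w k * weight w λs

multiplicityOK : (ℕ → Bool) → List ℕ → ℕ → Bool
multiplicityOK D λs x = if D x then mult x λs ≤ᵇ 1 else true

distinctOn : (ℕ → Bool) → List ℕ → Bool
distinctOn D λs = allᵇ (multiplicityOK D λs) λs

restrictedWeight : (ℕ → Bool) → (ℕ → ℤ) → List ℕ → ℤ
restrictedWeight D w λs = if distinctOn D λs then weight w λs else 0ℤ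

never always : ℕ → Bool
never  _ = false
always _ = true

ones minusOnes evenSign : ℕ → ℤ
ones      _ = 1ℤ
minusOnes _ = -1ℤ
evenSign  k = if isEven k then -1ℤ else 1ℤ

onlyEven : (ℕ → ℤ) → ℕ → ℤ
onlyEven w k = if isEven k then w k else 0ℤ

-- q ↦ −q
twist : (ℕ → ℤ) → ℕ → ℤ
twist w k = parity k * w k

evenCond : ℕ → Bool
evenCond x = if isEven x then x % 4 ≡ᵇ 2 else true

kWeight : ℕ → ℤ
kWeight k = if evenCond k then evenSign k else 0ℤ

allᵇ-cong-All : ∀ {A : Set} {p q : A → Bool} {xs} → All (λ x → p x ≡ q x) xs → allᵇ p xs ≡ allᵇ q xs
allᵇ-cong-All []             = refl
allᵇ-cong-All (px≡qx ∷ eqs) = cong₂ _∧_ px≡qx (allᵇ-cong-All eqs)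

multiplicityOK-head : ∀ D k λs → multiplicityOK D (k ∷ λs) k ≡ (if D k then mult k λs ≡ᵇ 0 else true)
multiplicityOK-head D k λs with D k
... | false = refl
... | true  = trans (cong (_≤ᵇ 1) (mult-head k λs)) (1+c≤ᵇ1 (mult k λs))
  where
  1+c≤ᵇ1 : ∀ c → (suc c ≤ᵇ 1) ≡ (c ≡ᵇ 0)
  1+c≤ᵇ1 zero    = refl
  1+c≤ᵇ1 (suc c) = refl

multiplicityOK-cons : ∀ D k λs x → (x ≡ k → D x ≡ false) →
                      multiplicityOK D (k ∷ λs) x ≡ multiplicityOK D λs x
multiplicityOK-cons D k λs x x≡k⇒¬Dx with x ≡ᵇ k | ≡ᵇ-reflects-≡ x k
... | false | _        = refl
... | true  | ofʸ x≡k rewrite x≡k⇒¬Dx x≡k = refl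

distinctOn-cons : ∀ D k λs →
  distinctOn D (k ∷ λs) ≡ ((if D k then mult k λs ≡ᵇ 0 else true) ∧ distinctOn D λs)
distinctOn-cons D k λs =
  trans (cong (_∧ allᵇ (multiplicityOK D (k ∷ λs)) λs) (multiplicityOK-head D k λs)) rest
  where
  rest : ((if D k then mult k λs ≡ᵇ 0 else true) ∧ allᵇ (multiplicityOK D (k ∷ λs)) λs)
       ≡ ((if D k then mult k λs ≡ᵇ 0 else true) ∧ distinctOn D λs)
  rest with D k in Dk≡false | mult k λs ≡ᵇ 0 | ≡ᵇ-reflects-≡ (mult k λs) 0
  ... | false | _     | _          =
    allᵇ-cong-All (All.universal (λ x → multiplicityOK-cons D k λs x (λ { refl → Dk≡false })) λs)
  ... | true  | true  | ofʸ mult≡0 =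
    allᵇ-cong-All (All.map (λ x≢k → multiplicityOK-cons D k λs _ (⊥-elim ∘ x≢k))
                           (mult≡0⇒absent λs mult≡0))
  ... | true  | false | _          = refl

restrictedWeight-cons : ∀ D w k λs → restrictedWeight D w (k ∷ λs) ≡
  w k * (if D k then (if mult k λs ≡ᵇ 0 then restrictedWeight D w λs else 0ℤ) else restrictedWeight D w λs)
restrictedWeight-cons D w k λs =
  trans (cong (λ b → if b then w k * weight w λs else 0ℤ) (distinctOn-cons D k λs))
        (factor (D k) (mult k λs ≡ᵇ 0) (distinctOn D λs))
  where
  factor : ∀ d c e → (if (if d then c else true) ∧ e then w k * weight w λs else 0ℤ)
         ≡ w k * (if d then (if c then (if e then weight w λs else 0ℤ) else 0ℤ)
                       else (if e then weight w λs else 0ℤ))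
  factor true  true  true  = refl
  factor true  true  false = sym (ℤₚ.*-zeroʳ (w k))
  factor true  false _     = sym (ℤₚ.*-zeroʳ (w k))
  factor false _     true  = refl
  factor false _     false = sym (ℤₚ.*-zeroʳ (w k))

partitionGF≤ : (ℕ → Bool) → (ℕ → ℤ) → ℕ → Series
partitionGF≤ D w m n = Σ (restrictedWeight D w) (boundedPartitions m n)

partitionGF : (ℕ → Bool) → (ℕ → ℤ) → Series
partitionGF D w n = partitionGF≤ D w n n

Σ-without-part : ∀ (W : List ℕ → ℤ) m r →
  Σ (λ μ → if mult (suc m) μ ≡ᵇ 0 then W μ else 0ℤ) (boundedPartitions (suc m) r) ≡
  Σ W (boundedPartitions m r)
Σ-without-part W m zero    = refl
Σ-without-part W m (suc r) = begin
  Σ W′ (boundedPartitions (suc m) (suc r))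
    ≡⟨ cong (Σ W′) (boundedPartitions-suc m r) ⟩
  Σ W′ (boundedPartitions m (suc r) ++ new)
    ≡⟨ Σ-++ W′ (boundedPartitions m (suc r)) new ⟩
  Σ W′ (boundedPartitions m (suc r)) + Σ W′ new
    ≡⟨ cong₂ _+_ (Σ-cong-All (All.map old-part (pb-bounded _ m (suc r)))) Σ-new ⟩
  Σ W (boundedPartitions m (suc r)) + 0ℤ
    ≡⟨ ℤₚ.+-identityʳ _ ⟩
  Σ W (boundedPartitions m (suc r)) ∎
  where
  open ≡-Reasoning
  W′ : List ℕ → ℤ
  W′ μ = if mult (suc m) μ ≡ᵇ 0 then W μ else 0ℤ
  new : List (List ℕ)
  new = if suc m ≤ᵇ suc r then map (suc m ∷_) (boundedPartitions (suc m) (r ∸ m)) else []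
  old-part : ∀ {μ} → All (_≤ m) μ → W′ μ ≡ W μ
  old-part μ≤m = cong (λ c → if c ≡ᵇ 0 then W _ else 0ℤ)
                      (mult-absent (All.map (λ x≤m x≡1+m → ℕₚ.<-irrefl x≡1+m (s≤s x≤m)) μ≤m))
  Σ-new : Σ W′ new ≡ 0ℤ
  Σ-new with suc m ≤ᵇ suc r
  ... | false = refl
  ... | true  = begin
    Σ W′ (map (suc m ∷_) L)  ≡⟨ Σ-map W′ (suc m ∷_) L ⟩
    Σ (W′ ∘ (suc m ∷_)) L    ≡⟨ Σ-cong repeated L ⟩
    Σ (λ _ → 0ℤ) L           ≡⟨ Σ-zero L ⟩
    0ℤ                       ∎
    where
    L = boundedPartitions (suc m) (r ∸ m)
    repeated : ∀ μ → W′ (suc m ∷ μ) ≡ 0ℤ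
    repeated μ = cong (λ c → if c ≡ᵇ 0 then W (suc m ∷ μ) else 0ℤ) (mult-head (suc m) μ)

partitionGF≤-suc : ∀ D w m → partitionGF≤ D w (suc m) ≗
  partitionGF≤ D w m ⊕
  shift (suc m) (w (suc m) · (if D (suc m) then partitionGF≤ D w m else partitionGF≤ D w (suc m)))
partitionGF≤-suc D w m zero    = refl
partitionGF≤-suc D w m (suc n) = begin
  Σ R (boundedPartitions (suc m) (suc n))   ≡⟨ cong (Σ R) (boundedPartitions-suc m n) ⟩
  Σ R (boundedPartitions m (suc n) ++ new)  ≡⟨ Σ-++ R (boundedPartitions m (suc n)) new ⟩
  partitionGF≤ D w m (suc n) + Σ R new      ≡⟨ cong (_+_ (partitionGF≤ D w m (suc n))) Σ-new ⟩
  partitionGF≤ D w m (suc n) + shift m X n  ∎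
  where
  open ≡-Reasoning
  R : List ℕ → ℤ
  R = restrictedWeight D w
  X : Series
  X = w (suc m) · (if D (suc m) then partitionGF≤ D w m else partitionGF≤ D w (suc m))
  new : List (List ℕ)
  new = if suc m ≤ᵇ suc n then map (suc m ∷_) (boundedPartitions (suc m) (n ∸ m)) else []
  Σ-new : Σ R new ≡ shift m X n
  Σ-new with suc m ≤ᵇ suc n | ℕₚ.≤ᵇ-reflects-≤ (suc m) (suc n)
  ... | false | ofⁿ 1+m≰1+n = sym (shift-below m X (ℕₚ.≰⇒> (1+m≰1+n ∘ s≤s)))
  ... | true  | ofʸ (s≤s m≤n) = begin
    Σ R (map (suc m ∷_) L)       ≡⟨ Σ-map R (suc m ∷_) L ⟩
    Σ (R ∘ (suc m ∷_)) L         ≡⟨ Σ-cong (restrictedWeight-cons D w (suc m)) L ⟩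
    Σ (λ μ → w (suc m) * Y μ) L  ≡⟨ Σ-*ˡ (w (suc m)) Y L ⟩
    w (suc m) * Σ Y L            ≡⟨ cong (w (suc m) *_) Σ-Y ⟩
    X (n ∸ m)                    ≡⟨ shift-above m X m≤n ⟨
    shift m X n                  ∎
    where
    L : List (List ℕ)
    L = boundedPartitions (suc m) (n ∸ m)
    Y : List ℕ → ℤ
    Y μ = if D (suc m) then (if mult (suc m) μ ≡ᵇ 0 then R μ else 0ℤ) else R μ
    Σ-Y : Σ Y L ≡ (if D (suc m) then partitionGF≤ D w m else partitionGF≤ D w (suc m)) (n ∸ m)
    Σ-Y with D (suc m)
    ... | true  = Σ-without-part R m (n ∸ m)
    ... | false = refl

partitionGF≤-suc-low : ∀ D w {m n} → n ≤ m → partitionGF≤ D w (suc m) n ≡ partitionGF≤ D w m n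
partitionGF≤-suc-low D w {m} {n} n≤m =
  trans (partitionGF≤-suc D w m n)
        (trans (cong (_+_ (partitionGF≤ D w m n)) (shift-below (suc m) _ (s≤s n≤m))) (ℤₚ.+-identityʳ _))

partitionGF≤-stable : ∀ D w {m n} → n ≤ m → partitionGF≤ D w m n ≡ partitionGF D w n
partitionGF≤-stable D w {m} {n} n≤m =
  subst (λ m → partitionGF≤ D w m n ≡ partitionGF D w n) (ℕₚ.m∸n+n≡m n≤m) (beyond (m ∸ n))
  where
  beyond : ∀ d → partitionGF≤ D w (d ℕ.+ n) n ≡ partitionGF D w n
  beyond zero    = refl
  beyond (suc d) = trans (partitionGF≤-suc-low D w (ℕₚ.m≤n+m n d)) (beyond d)

partitionGF≤-zero : ∀ D w → partitionGF≤ D w 0 ≗ one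
partitionGF≤-zero D w zero    = refl
partitionGF≤-zero D w (suc n) = refl

den num : (ℕ → Bool) → (ℕ → ℤ) → ℕ → Series
den D w k = binom (if D k then 0ℤ else - w k) k
num D w k = binom (if D k then w k else 0ℤ) k

factor-step : ∀ (d : Bool) c k {A B : Series} → B ≗ A ⊕ shift k (c · (if d then A else B)) →
              binom (if d then 0ℤ else - c) k ⊛ B ≗ binom (if d then c else 0ℤ) k ⊛ A
factor-step true  c k {A} {B} rec n = begin
  (binom 0ℤ k ⊛ B) n        ≡⟨ binom-⊛ 0ℤ k B n ⟩
  B n + 0ℤ                  ≡⟨ ℤₚ.+-identityʳ (B n) ⟩
  B n                       ≡⟨ rec n ⟩
  A n + shift k (c · A) n   ≡⟨ cong (_+_ (A n)) (shift-· k c A n) ⟩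
  A n + c * shift k A n     ≡⟨ binom-⊛ c k A n ⟨
  (binom c k ⊛ A) n         ∎
  where open ≡-Reasoning
factor-step false c k {A} {B} rec n = begin
  (binom (- c) k ⊛ B) n                         ≡⟨ binom-⊛ (- c) k B n ⟩
  B n + - c * shift k B n
    ≡⟨ cong (_+ - c * shift k B n) (trans (rec n) (cong (_+_ (A n)) (shift-· k c B n))) ⟩
  (A n + c * shift k B n) + - c * shift k B n   ≡⟨ cancel (A n) c (shift k B n) ⟩
  A n + 0ℤ                                      ≡⟨ binom-⊛ 0ℤ k A n ⟨
  (binom 0ℤ k ⊛ A) n                            ∎
  where
  open ≡-Reasoning
  cancel : ∀ a c s → (a + c * s) + - c * s ≡ a + 0ℤ
  cancel = solve-∀

-- Product identities modulo q ^ (N + 1)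

module Truncated (N : ℕ) where

  infix 4 _≈_
  _≈_ : Series → Series → Set
  a ≈ b = ∀ n → n ≤ N → a n ≡ b n

  ≈-isEquivalence : IsEquivalence _≈_
  ≈-isEquivalence = record
    { refl  = λ _ _ → refl
    ; sym   = λ a≈b n n≤N → sym (a≈b n n≤N)
    ; trans = λ a≈b b≈c n n≤N → trans (a≈b n n≤N) (b≈c n n≤N)
    }

  ≈-setoid : Setoid _ _
  ≈-setoid = record { isEquivalence = ≈-isEquivalence }

  open IsEquivalence ≈-isEquivalence public
    using () renaming (refl to ≈-refl; sym to ≈-sym; trans to ≈-trans)
  open import Relation.Binary.Reasoning.Setoid ≈-setoid public

  ≗⇒≈ : ∀ {a b} → a ≗ b → a ≈ b
  ≗⇒≈ a≗b n _ = a≗b n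

  ⊛-cong : ∀ {a a′ b b′} → a ≈ a′ → b ≈ b′ → a ⊛ b ≈ a′ ⊛ b′
  ⊛-cong a≈a′ b≈b′ n n≤N =
    ⊛-cong≤ n (λ i i≤n → a≈a′ i (ℕₚ.≤-trans i≤n n≤N))
              (λ i i≤n → b≈b′ i (ℕₚ.≤-trans i≤n n≤N))

  ⊛-congˡ : ∀ {a a′ b} → a ≈ a′ → a ⊛ b ≈ a′ ⊛ b
  ⊛-congˡ a≈a′ = ⊛-cong a≈a′ ≈-refl

  ⊛-congʳ : ∀ {a b b′} → b ≈ b′ → a ⊛ b ≈ a ⊛ b′
  ⊛-congʳ = ⊛-cong ≈-refl

  ⊛-interchange : ∀ a b c d → (a ⊛ b) ⊛ (c ⊛ d) ≈ (a ⊛ c) ⊛ (b ⊛ d)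
  ⊛-interchange a b c d = begin
    (a ⊛ b) ⊛ (c ⊛ d) ≈⟨ ≗⇒≈ (⊛-assoc a b (c ⊛ d)) ⟩
    a ⊛ (b ⊛ (c ⊛ d)) ≈⟨ ⊛-congʳ (≗⇒≈ (⊛-assoc b c d)) ⟨
    a ⊛ ((b ⊛ c) ⊛ d) ≈⟨ ⊛-congʳ (⊛-congˡ (≗⇒≈ (⊛-comm b c))) ⟩
    a ⊛ ((c ⊛ b) ⊛ d) ≈⟨ ⊛-congʳ (≗⇒≈ (⊛-assoc c b d)) ⟩
    a ⊛ (c ⊛ (b ⊛ d)) ≈⟨ ≗⇒≈ (⊛-assoc a c (b ⊛ d)) ⟨
    (a ⊛ c) ⊛ (b ⊛ d) ∎

  ⊛-cancelˡ : ∀ c {a b} → c 0 ≡ 1ℤ → c ⊛ a ≈ c ⊛ b → a ≈ b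
  ⊛-cancelˡ c c₀≡1 = ⊛-cancel≤ c c₀≡1 N

  ∏-cong : ∀ {F G} → (∀ k → F k ≈ G k) → ∀ M → ∏ F M ≈ ∏ G M
  ∏-cong F≈G zero    = ≈-refl
  ∏-cong F≈G (suc M) = ⊛-cong (∏-cong F≈G M) (F≈G (suc M))

  ∏-one : ∀ M → ∏ (λ _ → one) M ≈ one
  ∏-one zero    = ≈-refl
  ∏-one (suc M) = ≈-trans (≗⇒≈ (⊛-identityʳ _)) (∏-one M)

  ∏-⊛ : ∀ F G M → ∏ (λ k → F k ⊛ G k) M ≈ ∏ F M ⊛ ∏ G M
  ∏-⊛ F G zero    = ≈-sym (≗⇒≈ (⊛-identityˡ one))
  ∏-⊛ F G (suc M) = begin
    ∏ (λ k → F k ⊛ G k) M ⊛ (F (suc M) ⊛ G (suc M)) ≈⟨ ⊛-congˡ (∏-⊛ F G M) ⟩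
    (∏ F M ⊛ ∏ G M) ⊛ (F (suc M) ⊛ G (suc M))       ≈⟨ ⊛-interchange _ _ _ _ ⟩
    (∏ F M ⊛ F (suc M)) ⊛ (∏ G M ⊛ G (suc M))       ∎

  ∏-stable : ∀ {F} → Convergent F → ∀ {L} → N ≤ L → ∏ F L ≈ ∏ F N
  ∏-stable {F} F-conv N≤L = subst (λ L → ∏ F L ≈ ∏ F N) (ℕₚ.m∸n+n≡m N≤L) (beyond (_ ∸ N))
    where
    beyond : ∀ d → ∏ F (d ℕ.+ N) ≈ ∏ F N
    beyond zero    = ≈-refl
    beyond (suc d) = begin
      ∏ F (d ℕ.+ N) ⊛ F (suc (d ℕ.+ N))
        ≈⟨ ⊛-congʳ (λ n n≤N → F-conv (d ℕ.+ N) (ℕₚ.≤-trans n≤N (ℕₚ.m≤n+m N d))) ⟩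
      ∏ F (d ℕ.+ N) ⊛ one               ≈⟨ ≗⇒≈ (⊛-identityʳ _) ⟩
      ∏ F (d ℕ.+ N)                     ≈⟨ beyond d ⟩
      ∏ F N                             ∎

  ∏-onEven-double : ∀ F M → ∏ (onEven F) (double M) ≈ ∏ (F ∘ double) M
  ∏-onEven-double F zero    = ≈-refl
  ∏-onEven-double F (suc M) = begin
    (∏ (onEven F) (double M) ⊛ onEven F (suc (double M))) ⊛ onEven F (double (suc M))
      ≈⟨ ⊛-cong (⊛-congʳ (≗⇒≈ odd-factor)) (≗⇒≈ even-factor) ⟩
    (∏ (onEven F) (double M) ⊛ one) ⊛ F (double (suc M))
      ≈⟨ ⊛-congˡ (≗⇒≈ (⊛-identityʳ _)) ⟩
    ∏ (onEven F) (double M) ⊛ F (double (suc M))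
      ≈⟨ ⊛-congˡ (∏-onEven-double F M) ⟩
    ∏ (F ∘ double) M ⊛ F (double (suc M)) ∎
    where
    odd-factor : onEven F (suc (double M)) ≗ one
    odd-factor n = cong (λ b → (if b then F (suc (double M)) else one) n) (isEven-suc-double M)
    even-factor : onEven F (double (suc M)) ≗ F (double (suc M))
    even-factor n = cong (λ b → (if b then F (double (suc M)) else one) n) (isEven-double (suc M))

  ∏-onEven : ∀ {F} → Convergent F → ∏ (onEven F) N ≈ ∏ (F ∘ double) N
  ∏-onEven {F} F-conv = begin
    ∏ (onEven F) N          ≈⟨ ∏-stable (onEven-convergent {F} F-conv) (double-inflationary N) ⟨
    ∏ (onEven F) (double N) ≈⟨ ∏-onEven-double F N ⟩
    ∏ (F ∘ double) N        ∎

  ∏-odd-even : ∀ F M → ∏ F M ≈ ∏ (onOdd F) M ⊛ ∏ (onEven F) M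
  ∏-odd-even F M = ≈-trans (∏-cong split M) (∏-⊛ (onOdd F) (onEven F) M)
    where
    split : ∀ k → F k ≈ onOdd F k ⊛ onEven F k
    split k with isEven k
    ... | true  = ≈-sym (≗⇒≈ (⊛-identityˡ (F k)))
    ... | false = ≈-sym (≗⇒≈ (⊛-identityʳ (F k)))

  -- Euler's identity for xₖ = q ^ e k, so that x₂ₖ = xₖ²: as ∏ₖ (1 − xₖ) = ∏_{k odd} (1 − xₖ) · Z
  -- with Z = ∏ₖ (1 − x₂ₖ), we get ∏ₖ (1 + xₖ) · ∏_{k odd} (1 − xₖ) = ∏ₖ (1 − xₖ²) / Z = 1.
  euler : ∀ e → (∀ k → e (double k) ≡ e k ℕ.+ e k) → (∀ k → k ≤ e k) →
          ∏ (λ k → binom 1ℤ (e k)) N ⊛ ∏ (onOdd (λ k → binom -1ℤ (e k))) N ≈ one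
  euler e e-double e-inflationary = ⊛-cancelˡ Z Z₀≡1 (begin
    Z ⊛ (∏ P N ⊛ ∏ (onOdd M) N)   ≈⟨ ≗⇒≈ (⊛-comm Z _) ⟩
    (∏ P N ⊛ ∏ (onOdd M) N) ⊛ Z   ≈⟨ ≗⇒≈ (⊛-assoc _ _ Z) ⟩
    ∏ P N ⊛ (∏ (onOdd M) N ⊛ Z)   ≈⟨ ⊛-congʳ (∏-odd-even M N) ⟨
    ∏ P N ⊛ ∏ M N                 ≈⟨ ∏-⊛ P M N ⟨
    ∏ (λ k → P k ⊛ M k) N         ≈⟨ ∏-cong (λ k → ≗⇒≈ (P⊛M k)) N ⟩
    ∏ (M ∘ double) N              ≈⟨ ∏-onEven {M} M-convergent ⟨
    Z                             ≈⟨ ≗⇒≈ (⊛-identityʳ Z) ⟨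
    Z ⊛ one                       ∎)
    where
    P M : ℕ → Series
    P k = binom 1ℤ (e k)
    M k = binom -1ℤ (e k)
    M-convergent : Convergent M
    M-convergent = binom-convergent (λ _ → -1ℤ) e e-inflationary
    Z : Series
    Z = ∏ (onEven M) N
    Z₀≡1 : Z 0 ≡ 1ℤ
    Z₀≡1 = ∏-constant (onEven-convergent {M} M-convergent) N
    P⊛M : ∀ k → P k ⊛ M k ≗ M (double k)
    P⊛M k n = trans (binom-conj 1ℤ (e k) n) (cong (λ e → binom -1ℤ e n) (sym (e-double k)))

  ∏-⊛₃ : ∀ F G H M → ∏ (λ k → (F k ⊛ G k) ⊛ H k) M ≈ (∏ F M ⊛ ∏ G M) ⊛ ∏ H M
  ∏-⊛₃ F G H M = ≈-trans (∏-⊛ (λ k → F k ⊛ G k) H M) (⊛-congˡ (∏-⊛ F G M))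

  partitionGF≤-∏ : ∀ D w M → ∏ (den D w) M ⊛ partitionGF≤ D w M ≈ ∏ (num D w) M
  partitionGF≤-∏ D w zero    = ≗⇒≈ (λ n → trans (⊛-identityˡ _ n) (partitionGF≤-zero D w n))
  partitionGF≤-∏ D w (suc M) = begin
    (∏ (den D w) M ⊛ den D w (suc M)) ⊛ partitionGF≤ D w (suc M)
      ≈⟨ ≗⇒≈ (⊛-assoc _ _ _) ⟩
    ∏ (den D w) M ⊛ (den D w (suc M) ⊛ partitionGF≤ D w (suc M))
      ≈⟨ ⊛-congʳ (≗⇒≈ (factor-step (D (suc M)) (w (suc M)) (suc M) (partitionGF≤-suc D w M))) ⟩
    ∏ (den D w) M ⊛ (num D w (suc M) ⊛ partitionGF≤ D w M)
      ≈⟨ ⊛-congʳ (≗⇒≈ (⊛-comm _ _)) ⟩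
    ∏ (den D w) M ⊛ (partitionGF≤ D w M ⊛ num D w (suc M))
      ≈⟨ ≗⇒≈ (⊛-assoc _ _ _) ⟨
    (∏ (den D w) M ⊛ partitionGF≤ D w M) ⊛ num D w (suc M)
      ≈⟨ ⊛-congˡ (partitionGF≤-∏ D w M) ⟩
    ∏ (num D w) M ⊛ num D w (suc M) ∎

  partitionGF-∏ : ∀ D w → ∏ (den D w) N ⊛ partitionGF D w ≈ ∏ (num D w) N
  partitionGF-∏ D w =
    ≈-trans (⊛-congʳ (λ n n≤N → sym (partitionGF≤-stable D w n≤N))) (partitionGF≤-∏ D w N)

  ∏-den-constant : ∀ D w → ∏ (den D w) N 0 ≡ 1ℤ
  ∏-den-constant D w = ∏-constant (binomᵏ-convergent (λ k → if D k then 0ℤ else - w k)) N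

  partitionGF-quotient : ∀ u v D w →
    ∏ (den D w) N ≈ (∏ (den never u) N ⊛ ∏ (den never v) N) ⊛ ∏ (num D w) N →
    partitionGF never u ⊛ partitionGF never v ≈ partitionGF D w
  partitionGF-quotient u v D w cross = ⊛-cancelˡ C C₀≡1 (begin
      C ⊛ (a ⊛ b)              ≈⟨ ⊛-interchange Da Db a b ⟩
      (Da ⊛ a) ⊛ (Db ⊛ b)      ≈⟨ ⊛-cong (free u) (free v) ⟩
      one ⊛ one                ≈⟨ ≗⇒≈ (⊛-identityˡ one) ⟩
      one                      ≈⟨ C⊛h≈one ⟨
      C ⊛ h                    ∎)
    where
    a = partitionGF never u
    b = partitionGF never v
    h = partitionGF D w
    Da = ∏ (den never u) N
    Db = ∏ (den never v) N
    Dh = ∏ (den D w) N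
    C = Da ⊛ Db
    C₀≡1 : C 0 ≡ 1ℤ
    C₀≡1 = cong₂ _*_ (∏-den-constant never u) (∏-den-constant never v)
    free : ∀ x → ∏ (den never x) N ⊛ partitionGF never x ≈ one
    free x = ≈-trans (partitionGF-∏ never x) (≈-trans (∏-cong (λ k → ≗⇒≈ (binom-zero k)) N) (∏-one N))
    C⊛h≈one : C ⊛ h ≈ one
    C⊛h≈one = ⊛-cancelˡ Dh (∏-den-constant D w) (begin
      Dh ⊛ (C ⊛ h)   ≈⟨ ≗⇒≈ (⊛-assoc Dh C h) ⟨
      (Dh ⊛ C) ⊛ h   ≈⟨ ⊛-congˡ (≗⇒≈ (⊛-comm Dh C)) ⟩
      (C ⊛ Dh) ⊛ h   ≈⟨ ≗⇒≈ (⊛-assoc C Dh h) ⟩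
      C ⊛ (Dh ⊛ h)   ≈⟨ ⊛-congʳ (partitionGF-∏ D w) ⟩
      C ⊛ ∏ (num D w) N ≈⟨ cross ⟨
      Dh             ≈⟨ ≗⇒≈ (⊛-identityʳ Dh) ⟨
      Dh ⊛ one       ∎)

  ∏-onEven-minus : ∏ (onEven (binom -1ℤ)) N ≈ ∏ (binom -1ℤ ∘ double) N
  ∏-onEven-minus = ∏-onEven {binom -1ℤ} (binomᵏ-convergent (λ _ → -1ℤ))

  H-cross : ∏ (den isOdd ones) N ≈
    (∏ (den never evenSign) N ⊛ ∏ (den never (onlyEven ones)) N) ⊛ ∏ (num isOdd ones) N
  H-cross = begin
    ∏ (den isOdd ones) N        ≈⟨ ∏-cong lhs N ⟩
    ∏ (onEven (binom -1ℤ)) N    ≈⟨ ∏-onEven-minus ⟩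
    ∏ (binom -1ℤ ∘ double) N    ≈⟨ ∏-cong rhs N ⟨
    ∏ (λ k → (den never evenSign k ⊛ den never (onlyEven ones) k) ⊛ num isOdd ones k) N
      ≈⟨ ∏-⊛₃ _ _ _ N ⟩
    (∏ (den never evenSign) N ⊛ ∏ (den never (onlyEven ones)) N) ⊛ ∏ (num isOdd ones) N ∎
    where
    lhs : ∀ k → den isOdd ones k ≈ onEven (binom -1ℤ) k
    lhs k with isEven k
    ... | true  = ≈-refl
    ... | false = ≗⇒≈ (binom-zero k)
    rhs : ∀ k → (den never evenSign k ⊛ den never (onlyEven ones) k) ⊛ num isOdd ones k ≈ binom -1ℤ (double k)
    rhs k with isEven k
    ... | true  = ≗⇒≈ (λ n → trans (⊛-binom-zero _ k n) (binom-±1 1ℤ k refl n))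
    ... | false = ≈-trans (⊛-congˡ (≗⇒≈ (⊛-binom-zero _ k))) (≗⇒≈ (binom-±1 -1ℤ k refl))

  twisted-H-cross : ∏ (den isOdd (twist ones)) N ≈
    (∏ (den never minusOnes) N ⊛ ∏ (den never (onlyEven ones)) N) ⊛ ∏ (num isOdd (twist ones)) N
  twisted-H-cross = begin
    ∏ (den isOdd (twist ones)) N  ≈⟨ ∏-cong lhs N ⟩
    ∏ (onEven (binom -1ℤ)) N      ≈⟨ ∏-onEven-minus ⟩
    ∏ (binom -1ℤ ∘ double) N      ≈⟨ ∏-cong rhs N ⟨
    ∏ (λ k → (den never minusOnes k ⊛ den never (onlyEven ones) k) ⊛ num isOdd (twist ones) k) N
      ≈⟨ ∏-⊛₃ _ _ _ N ⟩
    (∏ (den never minusOnes) N ⊛ ∏ (den never (onlyEven ones)) N) ⊛ ∏ (num isOdd (twist ones)) N ∎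
    where
    lhs : ∀ k → den isOdd (twist ones) k ≈ onEven (binom -1ℤ) k
    lhs k rewrite parity≡sign k with isEven k
    ... | true  = ≈-refl
    ... | false = ≗⇒≈ (binom-zero k)
    rhs : ∀ k → (den never minusOnes k ⊛ den never (onlyEven ones) k) ⊛ num isOdd (twist ones) k ≈
                binom -1ℤ (double k)
    rhs k rewrite parity≡sign k with isEven k
    ... | true  = ≗⇒≈ (λ n → trans (⊛-binom-zero _ k n) (binom-±1 1ℤ k refl n))
    ... | false = ≈-trans (⊛-congˡ (≗⇒≈ (⊛-binom-zero _ k))) (≗⇒≈ (binom-±1 1ℤ k refl))

  twisted-K-cross : ∏ (den always (twist kWeight)) N ≈
    (∏ (den never minusOnes) N ⊛ ∏ (den never (onlyEven minusOnes)) N) ⊛ ∏ (num always (twist kWeight)) N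
  twisted-K-cross = begin
    ∏ (den always (twist kWeight)) N  ≈⟨ ∏-cong (λ k → ≗⇒≈ (binom-zero k)) N ⟩
    ∏ (λ _ → one) N                   ≈⟨ ∏-one N ⟩
    one                               ≈⟨ ≗⇒≈ (⊛-identityˡ one) ⟨
    one ⊛ one
      ≈⟨ ⊛-cong (euler (λ k → k) double≡+ (λ _ → ℕₚ.≤-refl))
                (euler double (double≡+ ∘ double) double-inflationary) ⟨
    (∏ (binom 1ℤ) N ⊛ ∏ (onOdd (binom -1ℤ)) N) ⊛
    (∏ (binom 1ℤ ∘ double) N ⊛ ∏ (onOdd (binom -1ℤ ∘ double)) N)
      ≈⟨ ⊛-interchange _ _ _ _ ⟩
    (∏ (binom 1ℤ) N ⊛ ∏ (binom 1ℤ ∘ double) N) ⊛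
    (∏ (onOdd (binom -1ℤ)) N ⊛ ∏ (onOdd (binom -1ℤ ∘ double)) N)
      ≈⟨ ⊛-cong (⊛-congʳ evenParts) numerator ⟨
    (∏ (den never minusOnes) N ⊛ ∏ (den never (onlyEven minusOnes)) N) ⊛ ∏ (num always (twist kWeight)) N ∎
    where
    evenParts : ∏ (den never (onlyEven minusOnes)) N ≈ ∏ (binom 1ℤ ∘ double) N
    evenParts = ≈-trans (∏-cong plus N) (∏-onEven {binom 1ℤ} (binomᵏ-convergent (λ _ → 1ℤ)))
      where
      plus : ∀ k → den never (onlyEven minusOnes) k ≈ onEven (binom 1ℤ) k
      plus k with isEven k
      ... | true  = ≈-refl
      ... | false = ≗⇒≈ (binom-zero k)
    c₂ : ℕ → ℤ
    c₂ k = if k % 4 ≡ᵇ 2 then -1ℤ else 0ℤ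
    F₂ : ℕ → Series
    F₂ k = binom (c₂ k) k
    split : ∀ k → num always (twist kWeight) k ≈ onOdd (binom -1ℤ) k ⊛ onEven F₂ k
    split k rewrite parity≡sign k with isEven k | k % 4 ≡ᵇ 2
    ... | true  | true  = ≈-sym (≗⇒≈ (⊛-identityˡ _))
    ... | true  | false = ≈-sym (≗⇒≈ (⊛-identityˡ _))
    ... | false | _     = ≈-sym (≗⇒≈ (⊛-identityʳ _))
    halve : ∀ j → F₂ (double j) ≈ onOdd (binom -1ℤ ∘ double) j
    halve j rewrite double-mod4 j with isEven j
    ... | true  = ≗⇒≈ (binom-zero (double j))
    ... | false = ≈-refl
    numerator : ∏ (num always (twist kWeight)) N ≈ ∏ (onOdd (binom -1ℤ)) N ⊛ ∏ (onOdd (binom -1ℤ ∘ double)) N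
    numerator = begin
      ∏ (num always (twist kWeight)) N                  ≈⟨ ∏-cong split N ⟩
      ∏ (λ k → onOdd (binom -1ℤ) k ⊛ onEven F₂ k) N     ≈⟨ ∏-⊛ _ _ N ⟩
      ∏ (onOdd (binom -1ℤ)) N ⊛ ∏ (onEven F₂) N         ≈⟨ ⊛-congʳ (∏-onEven {F₂} (binomᵏ-convergent c₂)) ⟩
      ∏ (onOdd (binom -1ℤ)) N ⊛ ∏ (F₂ ∘ double) N       ≈⟨ ⊛-congʳ (∏-cong halve N) ⟩
      ∏ (onOdd (binom -1ℤ)) N ⊛ ∏ (onOdd (binom -1ℤ ∘ double)) N ∎

≗-from-truncations : ∀ {a b} → (∀ N → Truncated._≈_ N a b) → a ≗ b
≗-from-truncations a≈b n = a≈b n n ℕₚ.≤-refl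

-- 1 / ((−q²; q²)∞ (q; q²)∞) · 1 / (q²; q²)∞ = (−q; q²)∞ / (q²; q²)∞
H-identity : partitionGF never evenSign ⊛ partitionGF never (onlyEven ones) ≗ partitionGF isOdd ones
H-identity = ≗-from-truncations λ N → let open Truncated N in
  partitionGF-quotient evenSign (onlyEven ones) isOdd ones H-cross

-- 1 / (−q; q)∞ · 1 / (q²; q²)∞ = (q; q²)∞ / (q²; q²)∞
twisted-H-identity :
  partitionGF never minusOnes ⊛ partitionGF never (onlyEven ones) ≗ partitionGF isOdd (twist ones)
twisted-H-identity = ≗-from-truncations λ N → let open Truncated N in
  partitionGF-quotient minusOnes (onlyEven ones) isOdd (twist ones) twisted-H-cross

-- 1 / (−q; q)∞ · 1 / (−q²; q²)∞ = (q; q²)∞ (q²; q⁴)∞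
twisted-K-identity :
  partitionGF never minusOnes ⊛ partitionGF never (onlyEven minusOnes) ≗ partitionGF always (twist kWeight)
twisted-K-identity = ≗-from-truncations λ N → let open Truncated N in
  partitionGF-quotient minusOnes (onlyEven minusOnes) always (twist kWeight) twisted-K-cross

-- The signed counts

weight-ones : ∀ λs → weight ones λs ≡ 1ℤ
weight-ones []       = refl
weight-ones (k ∷ λs) = trans (ℤₚ.*-identityˡ _) (weight-ones λs)

weight-restrict : ∀ p w λs →
  weight (λ k → if p k then w k else 0ℤ) λs ≡ (if allᵇ p λs then weight w λs else 0ℤ)
weight-restrict p w []       = refl
weight-restrict p w (k ∷ λs) with p k | allᵇ p λs | weight-restrict p w λs
... | true  | true  | ih = cong (w k *_) ih
... | true  | false | ih = trans (cong (w k *_) ih) (ℤₚ.*-zeroʳ (w k))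
... | false | _     | _  = refl

weight-evenSign : ∀ λs → weight evenSign λs ≡ parity (count isEven λs)
weight-evenSign []       = refl
weight-evenSign (k ∷ λs) with isEven k
... | true  = trans (cong (-1ℤ *_) (weight-evenSign λs)) (sym (parity-+ 1 (count isEven λs)))
... | false = trans (ℤₚ.*-identityˡ _) (weight-evenSign λs)

weight-minusOnes : ∀ λs → weight minusOnes λs ≡ parity (length λs)
weight-minusOnes []       = refl
weight-minusOnes (k ∷ λs) = trans (cong (-1ℤ *_) (weight-minusOnes λs)) (sym (parity-+ 1 (length λs)))

weight-twist : ∀ w λs → weight (twist w) λs ≡ parity (sum λs) * weight w λs
weight-twist w []       = refl
weight-twist w (k ∷ λs) = begin
  parity k * w k * weight (twist w) λs            ≡⟨ cong (parity k * w k *_) (weight-twist w λs) ⟩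
  parity k * w k * (parity (sum λs) * weight w λs) ≡⟨ regroup (parity k) (w k) (parity (sum λs)) (weight w λs) ⟩
  parity k * parity (sum λs) * (w k * weight w λs) ≡⟨ cong (_* (w k * weight w λs)) (parity-+ k (sum λs)) ⟨
  parity (k ℕ.+ sum λs) * (w k * weight w λs)     ∎
  where
  open ≡-Reasoning
  regroup : ∀ p a q b → p * a * (q * b) ≡ p * q * (a * b)
  regroup = solve-∀

restrictedWeight-never : ∀ w λs → restrictedWeight never w λs ≡ weight w λs
restrictedWeight-never w λs = cong (λ b → if b then weight w λs else 0ℤ) (allᵇ-true λs)
  where
  allᵇ-true : ∀ xs → allᵇ (multiplicityOK never λs) xs ≡ true
  allᵇ-true []       = refl
  allᵇ-true (x ∷ xs) = allᵇ-true xs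

partitionGF-twist : ∀ D w n → partitionGF D (twist w) n ≡ parity n * partitionGF D w n
partitionGF-twist D w n =
  trans (Σ-cong-All (All.map (λ {λs} → twisted {λs}) (pb-sum (n ℕ.+ n) n n)))
        (Σ-*ˡ (parity n) (restrictedWeight D w) (partitions n))
  where
  twisted : ∀ {λs} → sum λs ≡ n → restrictedWeight D (twist w) λs ≡ parity n * restrictedWeight D w λs
  twisted {λs} sum≡n with distinctOn D λs
  ... | true  = trans (weight-twist w λs) (cong (λ s → parity s * weight w λs) sum≡n)
  ... | false = sym (ℤₚ.*-zeroʳ (parity n))

count-Σ : ∀ {A : Set} (p : A → Bool) xs → + count p xs ≡ Σ (λ x → if p x then 1ℤ else 0ℤ) xs
count-Σ p []       = refl
count-Σ p (x ∷ xs) with p x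
... | true  = cong (_+_ 1ℤ) (count-Σ p xs)
... | false = trans (count-Σ p xs) (sym (ℤₚ.+-identityˡ _))

H≡partitionGF : ∀ n → + H n ≡ partitionGF isOdd ones n
H≡partitionGF n = trans (count-Σ oddPartsDistinct (partitions n)) (Σ-cong weigh (partitions n))
  where
  weigh : ∀ λs → (if oddPartsDistinct λs then 1ℤ else 0ℤ) ≡ restrictedWeight isOdd ones λs
  weigh λs = cong (λ x → if oddPartsDistinct λs then x else 0ℤ) (sym (weight-ones λs))

K≡partitionGF : ∀ n → K n ≡ partitionGF always kWeight n
K≡partitionGF n = trans (Σ-filterᵇ KAdmissible _ (partitions n)) (Σ-cong weigh (partitions n))
  where
  weigh : ∀ λs → (if KAdmissible λs then parity (count isEven λs) else 0ℤ) ≡ restrictedWeight always kWeight λs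
  weigh λs with allᵇ (λ x → mult x λs ≤ᵇ 1) λs
  ... | false = refl
  ... | true  = sym (trans (weight-restrict evenCond evenSign λs)
                           (cong (λ x → if allᵇ evenCond λs then x else 0ℤ) (weight-evenSign λs)))

⊛-as-Σ : ∀ a b n → (a ⊛ b) n ≡ Σ (λ i → a i * b (n ∸ i)) (upTo (suc n))
⊛-as-Σ a b zero    = sym (ℤₚ.+-identityʳ (a 0 * b 0))
⊛-as-Σ a b (suc n) = cong (_+_ (a 0 * b (suc n))) (begin
  (tail a ⊛ b) n                         ≡⟨ ⊛-as-Σ (tail a) b n ⟩
  Σ (f ∘ suc) (upTo (suc n))             ≡⟨ Σ-map f suc (upTo (suc n)) ⟨
  Σ f (map suc (upTo (suc n)))           ≡⟨ cong (Σ f) (map-upTo suc (suc n)) ⟩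
  Σ f (applyUpTo suc (suc n))            ∎)
  where
  open ≡-Reasoning
  f : ℕ → ℤ
  f i = a i * b (suc n ∸ i)

Σ-twoColor : ∀ (f g : List ℕ → ℤ) n → Σ (λ x → f (proj₁ x) * g (proj₂ x)) (twoColor n) ≡
             ((λ a → Σ f (partitions a)) ⊛ (λ a → Σ g (partitions a))) n
Σ-twoColor f g n = begin
  Σ F (concatMap (λ a → concatMap (pairs a) (partitions a)) (upTo (suc n)))
    ≡⟨ Σ-concatMap F (λ a → concatMap (pairs a) (partitions a)) (upTo (suc n)) ⟩
  Σ (λ a → Σ F (concatMap (pairs a) (partitions a))) (upTo (suc n))
    ≡⟨ Σ-cong split (upTo (suc n)) ⟩
  Σ (λ a → Σ f (partitions a) * Σ g (partitions (n ∸ a))) (upTo (suc n))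
    ≡⟨ ⊛-as-Σ (λ a → Σ f (partitions a)) (λ a → Σ g (partitions a)) n ⟨
  ((λ a → Σ f (partitions a)) ⊛ (λ a → Σ g (partitions a))) n ∎
  where
  open ≡-Reasoning
  F : List ℕ × List ℕ → ℤ
  F x = f (proj₁ x) * g (proj₂ x)
  pairs : ℕ → List ℕ → List (List ℕ × List ℕ)
  pairs a β = map (β ,_) (partitions (n ∸ a))
  split : ∀ a → Σ F (concatMap (pairs a) (partitions a)) ≡ Σ f (partitions a) * Σ g (partitions (n ∸ a))
  split a = begin
    Σ F (concatMap (pairs a) (partitions a))               ≡⟨ Σ-concatMap F (pairs a) (partitions a) ⟩
    Σ (λ β → Σ F (pairs a β)) (partitions a)               ≡⟨ Σ-cong row (partitions a) ⟩
    Σ (λ β → f β * Σ g (partitions (n ∸ a))) (partitions a)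
      ≡⟨ Σ-*ʳ (Σ g (partitions (n ∸ a))) f (partitions a) ⟩
    Σ f (partitions a) * Σ g (partitions (n ∸ a))          ∎
    where
    row : ∀ β → Σ F (pairs a β) ≡ f β * Σ g (partitions (n ∸ a))
    row β = trans (Σ-map F (β ,_) (partitions (n ∸ a))) (Σ-*ˡ (f β) g (partitions (n ∸ a)))

Σ-Gset : ∀ u v n → Σ (λ x → weight u (proj₁ x) * weight v (proj₂ x)) (Gset n) ≡
         (partitionGF never u ⊛ partitionGF never (onlyEven v)) n
Σ-Gset u v n = begin
  Σ F (filterᵇ oddOnlyBlue (twoColor n))
    ≡⟨ Σ-filterᵇ oddOnlyBlue F (twoColor n) ⟩
  Σ (λ x → if oddOnlyBlue x then F x else 0ℤ) (twoColor n)
    ≡⟨ Σ-cong green-even (twoColor n) ⟩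
  Σ (λ x → weight u (proj₁ x) * weight (onlyEven v) (proj₂ x)) (twoColor n)
    ≡⟨ Σ-twoColor (weight u) (weight (onlyEven v)) n ⟩
  ((λ a → Σ (weight u) (partitions a)) ⊛ (λ a → Σ (weight (onlyEven v)) (partitions a))) n
    ≡⟨ ⊛-cong≤ n (λ a _ → unrestricted u a) (λ a _ → unrestricted (onlyEven v) a) ⟩
  (partitionGF never u ⊛ partitionGF never (onlyEven v)) n ∎
  where
  open ≡-Reasoning
  F : List ℕ × List ℕ → ℤ
  F x = weight u (proj₁ x) * weight v (proj₂ x)
  green-even : ∀ x → (if oddOnlyBlue x then F x else 0ℤ) ≡ weight u (proj₁ x) * weight (onlyEven v) (proj₂ x)
  green-even (β , γ) rewrite weight-restrict isEven v γ with allᵇ isEven γ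
  ... | true  = refl
  ... | false = sym (ℤₚ.*-zeroʳ (weight u β))
  unrestricted : ∀ w a → Σ (weight w) (partitions a) ≡ partitionGF never w a
  unrestricted w a = sym (Σ-cong (restrictedWeight-never w) (partitions a))

evenBlueEvens evenBlueParts evenParts : List ℕ × List ℕ → Bool
evenBlueEvens (β , γ) = isEven (count isEven β)
evenBlueParts (β , γ) = isEven (length β)
evenParts     (β , γ) = isEven (length β ℕ.+ length γ)

Σ-sign-evenBlueEvens : ∀ n → Σ (sign ∘ evenBlueEvens) (Gset n) ≡ + H n
Σ-sign-evenBlueEvens n = begin
  Σ (sign ∘ evenBlueEvens) (Gset n)                                       ≡⟨ Σ-cong as-weight (Gset n) ⟩
  Σ (λ x → weight evenSign (proj₁ x) * weight ones (proj₂ x)) (Gset n)   ≡⟨ Σ-Gset evenSign ones n ⟩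
  (partitionGF never evenSign ⊛ partitionGF never (onlyEven ones)) n     ≡⟨ H-identity n ⟩
  partitionGF isOdd ones n                                               ≡⟨ H≡partitionGF n ⟨
  + H n                                                                  ∎
  where
  open ≡-Reasoning
  as-weight : ∀ x → sign (evenBlueEvens x) ≡ weight evenSign (proj₁ x) * weight ones (proj₂ x)
  as-weight (β , γ) = sym (begin
    weight evenSign β * weight ones γ ≡⟨ cong₂ _*_ (weight-evenSign β) (weight-ones γ) ⟩
    parity (count isEven β) * 1ℤ      ≡⟨ ℤₚ.*-identityʳ _ ⟩
    parity (count isEven β)           ≡⟨ parity≡sign (count isEven β) ⟩
    sign (isEven (count isEven β))    ∎)

Σ-sign-evenBlueParts : ∀ n → Σ (sign ∘ evenBlueParts) (Gset n) ≡ parity n * + H n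
Σ-sign-evenBlueParts n = begin
  Σ (sign ∘ evenBlueParts) (Gset n)                                      ≡⟨ Σ-cong as-weight (Gset n) ⟩
  Σ (λ x → weight minusOnes (proj₁ x) * weight ones (proj₂ x)) (Gset n) ≡⟨ Σ-Gset minusOnes ones n ⟩
  (partitionGF never minusOnes ⊛ partitionGF never (onlyEven ones)) n   ≡⟨ twisted-H-identity n ⟩
  partitionGF isOdd (twist ones) n                                      ≡⟨ partitionGF-twist isOdd ones n ⟩
  parity n * partitionGF isOdd ones n                                   ≡⟨ cong (parity n *_) (H≡partitionGF n) ⟨
  parity n * + H n                                                      ∎
  where
  open ≡-Reasoning
  as-weight : ∀ x → sign (evenBlueParts x) ≡ weight minusOnes (proj₁ x) * weight ones (proj₂ x)
  as-weight (β , γ) = sym (begin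
    weight minusOnes β * weight ones γ ≡⟨ cong₂ _*_ (weight-minusOnes β) (weight-ones γ) ⟩
    parity (length β) * 1ℤ             ≡⟨ ℤₚ.*-identityʳ _ ⟩
    parity (length β)                  ≡⟨ parity≡sign (length β) ⟩
    sign (isEven (length β))           ∎)

Σ-sign-evenParts : ∀ n → Σ (sign ∘ evenParts) (Gset n) ≡ parity n * K n
Σ-sign-evenParts n = begin
  Σ (sign ∘ evenParts) (Gset n)                                               ≡⟨ Σ-cong as-weight (Gset n) ⟩
  Σ (λ x → weight minusOnes (proj₁ x) * weight minusOnes (proj₂ x)) (Gset n) ≡⟨ Σ-Gset minusOnes minusOnes n ⟩
  (partitionGF never minusOnes ⊛ partitionGF never (onlyEven minusOnes)) n   ≡⟨ twisted-K-identity n ⟩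
  partitionGF always (twist kWeight) n                                       ≡⟨ partitionGF-twist always kWeight n ⟩
  parity n * partitionGF always kWeight n                                    ≡⟨ cong (parity n *_) (K≡partitionGF n) ⟨
  parity n * K n                                                             ∎
  where
  open ≡-Reasoning
  as-weight : ∀ x → sign (evenParts x) ≡ weight minusOnes (proj₁ x) * weight minusOnes (proj₂ x)
  as-weight (β , γ) = sym (begin
    weight minusOnes β * weight minusOnes γ ≡⟨ cong₂ _*_ (weight-minusOnes β) (weight-minusOnes γ) ⟩
    parity (length β) * parity (length γ)   ≡⟨ parity-+ (length β) (length γ) ⟨
    parity (length β ℕ.+ length γ)          ≡⟨ parity≡sign (length β ℕ.+ length γ) ⟩
    sign (isEven (length β ℕ.+ length γ))   ∎)

count-sign : ∀ {A : Set} (p : A → Bool) xs → + 2 * + count p xs ≡ + length xs + Σ (sign ∘ p) xs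
count-sign p []       = refl
count-sign p (x ∷ xs) with p x
... | true  = begin
  + 2 * (1ℤ + + count p xs)                  ≡⟨ double-suc (+ count p xs) ⟩
  + 2 + + 2 * + count p xs                   ≡⟨ cong (_+_ (+ 2)) (count-sign p xs) ⟩
  + 2 + (+ length xs + Σ (sign ∘ p) xs)      ≡⟨ regroup (+ length xs) (Σ (sign ∘ p) xs) ⟩
  (1ℤ + + length xs) + (1ℤ + Σ (sign ∘ p) xs) ∎
  where
  open ≡-Reasoning
  double-suc : ∀ c → + 2 * (1ℤ + c) ≡ + 2 + + 2 * c
  double-suc = solve-∀
  regroup : ∀ l s → + 2 + (l + s) ≡ (1ℤ + l) + (1ℤ + s)
  regroup = solve-∀
... | false = trans (count-sign p xs) (regroup (+ length xs) (Σ (sign ∘ p) xs))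
  where
  regroup : ∀ l s → l + s ≡ (1ℤ + l) + (-1ℤ + s)
  regroup = solve-∀

Σ-sign-not : ∀ {A : Set} (p : A → Bool) xs → Σ (sign ∘ not ∘ p) xs ≡ - Σ (sign ∘ p) xs
Σ-sign-not p xs = begin
  Σ (sign ∘ not ∘ p) xs              ≡⟨ Σ-cong (λ x → sign-not (p x)) xs ⟩
  Σ (λ x → -1ℤ * sign (p x)) xs      ≡⟨ Σ-*ˡ -1ℤ (sign ∘ p) xs ⟩
  -1ℤ * Σ (sign ∘ p) xs              ≡⟨ ℤₚ.-1*i≡-i _ ⟩
  - Σ (sign ∘ p) xs                  ∎
  where
  open ≡-Reasoning
  sign-not : ∀ b → sign (not b) ≡ -1ℤ * sign b
  sign-not true  = refl
  sign-not false = refl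

signed-count : ∀ {A : Set} (p : A → Bool) xs {s} → Σ (sign ∘ p) xs ≡ s →
  (+ 2 * + count p xs ≡ + length xs + s) × (+ 2 * + count (not ∘ p) xs ≡ + length xs - s)
signed-count p xs Σ≡s =
    trans (count-sign p xs) (cong (_+_ (+ length xs)) Σ≡s)
  , trans (count-sign (not ∘ p) xs) (cong (_+_ (+ length xs)) (trans (Σ-sign-not p xs) (cong -_ Σ≡s)))

theorem1p5 : (n : ℕ) →
    (+ 2 * + G₀ n ≡ + G n + + H n) ×
    (+ 2 * + G₁ n ≡ + G n - + H n) ×
    (+ 2 * + G₂ n ≡ + G n + parity n * + H n) ×
    (+ 2 * + G₃ n ≡ + G n - parity n * + H n) ×
    (+ 2 * + G₄ n ≡ + G n + parity n * K n) ×
    (+ 2 * + G₅ n ≡ + G n - parity n * K n)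
theorem1p5 n =
  let a′ , b′ = signed-count evenBlueEvens (Gset n) (Σ-sign-evenBlueEvens n)
      c′ , d′ = signed-count evenBlueParts (Gset n) (Σ-sign-evenBlueParts n)
      e′ , f′ = signed-count evenParts     (Gset n) (Σ-sign-evenParts n)
  in  a′ , b′ , c′ , d′ , e′ , f′
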